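{- For every terrain-like graph $G\in\mathcal{T}_n$, it holds that $\Gamma(\Pi(G))=G$.
   Context: $[n]=\{1,\dots,n\}$; $\mathcal{S}_{2n}$ is the symmetric group on $[2n]$, with product meaning composition, $(\sigma\rho)(x)=\sigma(\rho(x))$; $(a,b)$ denotes a transposition. A graph $G=([n],E)$ is terrain-like if for all $a<b<c<d$, $\{a,c\},\{b,d\}\in E$ implies $\{a,d\}\in E$; $\mathcal{T}_n$ is the set of these. On $\binom{[n]}{2}$ define $\preceq$ by: for $a<b$, $c<d$, $\{a,b\}\preceq\{c,d\}$ iff $c\le a<b\le d$. A valid ordering of a subset of $\binom{[n]}{2}$ is a total order $\le$ on it with $e\preceq e'\Rightarrow e\le e'$. For $a<b$ let $\tau(\{a,b\})=(2a,2b-1)$ and $\pi_0=(1,2)(3,4)\cdots(2n-1,2n)$. For $E=\{e_1>\dots>e_m\}$ in a valid ordering, $\Pi(G)=\tau(e_m)\cdots\tau(e_1)\pi_0$ (independent of the ordering). For $\sigma\in\mathcal{S}_{2n}$ and $2\le i<j\le 2n-1$, $i$ even, $j$ odd, $i$ and $j$ are in edge configuration in $\sigma$ if ($\sigma^{ -1}(i)<\sigma^{ -1}(j)$ iff $\sigma^{ -1}(i)\equiv\sigma^{ -1}(j)\pmod 2$). The map $\Gamma$ on permutations $\pi$: start with $\sigma:=\pi$ and the edgeless graph on $[n]$; iterate over all $\{u,v\}\in\binom{[n]}{2}$, $u<v$, in increasing order w.r.t. a valid total order of $\binom{[n]}{2}$; if $2u$ and $2v-1$ are in edge configuration in the current $\sigma$,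 insert edge $\{u,v\}$ and replace $\sigma$ by $(2u,2v-1)\sigma$; the final graph is $\Gamma(\pi)$ (independent of the valid order). -}

module Defs where

open import Data.Nat as ℕ using (ℕ; zero; suc; _%_; _≡ᵇ_; _<ᵇ_)
open import Data.Fin using (Fin; zero; suc; toℕ; combine; _<_; _≤_; _≟_)
open import Data.Fin.Permutation using (Permutation′; _∘ₚ_; transpose; id; _⟨$⟩ʳ_; _⟨$⟩ˡ_)
open import Data.Bool using (Bool; true; false; if_then_else_; not; _xor_; _∧_; _∨_)
open import Data.List using (List; []; _∷_; foldr; foldl; allFin; length; lookup)
open import Data.List.Relation.Unary.All using (All)
open import Data.List.Relation.Unary.Unique.Propositional using (Unique)
open import Data.List.Membership.Propositional using (_∈_)
open import Data.Product using (_×_; _,_; proj₁; proj₂)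
open import Relation.Binary.PropositionalEquality using (_≡_)
open import Relation.Nullary.Decidable using (⌊_⌋)
open import Function.Bundles using (_⇔_)
open import Data.Unit using (⊤)

-- Vertex a ∈ [n] is represented by (a' : Fin n) with a = toℕ a' + 1.
-- Point x ∈ [2n] is represented by (x' : Fin (n * 2)) with x = toℕ x' + 1.
-- A graph on [n] is given by its edge indicator on pairs (u , v) with u < v;
-- the values at pairs with u ≥ v are irrelevant (never consulted).

Graph : ℕ → Set
Graph n = Fin n → Fin n → Bool

_≐_ : ∀ {n} → Graph n → Graph n → Set
_≐_ {n} G H = ∀ (u v : Fin n) → u < v → G u v ≡ H u v

TerrainLike : ∀ {n} → Graph n → Set
TerrainLike {n} G = ∀ (a b c d : Fin n) → a < b → b < c → c < d →
  G a c ≡ true → G b d ≡ true → G a d ≡ true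

-- pairs (u , v) standing for {u,v} with u < v
Pair : ℕ → Set
Pair n = Fin n × Fin n

_⪯_ : ∀ {n} → Pair n → Pair n → Set
(a , b) ⪯ (c , d) = (c ≤ a) × (b ≤ d)

ValidOrdering : ∀ {n} → (Pair n → Set) → List (Pair n) → Set
ValidOrdering {n} S L =
  All (λ p → proj₁ p < proj₂ p) L ×
  Unique L ×
  (∀ (u v : Fin n) → u < v → ((u , v) ∈ L ⇔ S (u , v))) ×
  (∀ (i j : Fin (length L)) → lookup L i ⪯ lookup L j → toℕ i ℕ.≤ toℕ j)

Perm : ℕ → Set
Perm n = Permutation′ (n ℕ.* 2)

-- paper product: (σ · ρ)(x) = σ(ρ(x))
_·_ : ∀ {n} → Perm n → Perm n → Perm n
σ · ρ = ρ ∘ₚ σ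

evenPt : ∀ {n} → Fin n → Fin (n ℕ.* 2)
evenPt a = combine a (suc zero)   -- 0-based 2·a'+1, i.e. 1-based 2a

oddPt : ∀ {n} → Fin n → Fin (n ℕ.* 2)
oddPt a = combine a zero          -- 0-based 2·a', i.e. 1-based 2a-1

τ : ∀ {n} → Pair n → Perm n
τ {n} (a , b) = transpose (evenPt {n} a) (oddPt {n} b)

π₀ : (n : ℕ) → Perm n
π₀ n = foldr (λ k acc → _·_ {n} (transpose (oddPt k) (evenPt k)) acc) id (allFin n)

-- Π(G) = τ(e_m)⋯τ(e_1) π₀, where L = e_m , … , e_1 lists E increasingly
-- in a valid ordering.
Π : ∀ {n} → List (Pair n) → Perm n
Π {n} L = foldr (λ e acc → _·_ {n} (τ e) acc) (π₀ n) L

-- i and j are in edge configuration in σ: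
-- σ⁻¹(i) < σ⁻¹(j)  iff  σ⁻¹(i) ≡ σ⁻¹(j) (mod 2)
-- (0-based positions: shifting by one preserves both sides)
edgeConfig : ∀ {n} → Perm n → Fin (n ℕ.* 2) → Fin (n ℕ.* 2) → Bool
edgeConfig σ i j =
  not ((toℕ (σ ⟨$⟩ˡ i) <ᵇ toℕ (σ ⟨$⟩ˡ j)) xor
       ((toℕ (σ ⟨$⟩ˡ i) % 2) ≡ᵇ (toℕ (σ ⟨$⟩ˡ j) % 2)))

emptyGraph : ∀ {n} → Graph n
emptyGraph _ _ = false

addEdge : ∀ {n} → Pair n → Graph n → Graph n
addEdge (u , v) G x y = (⌊ x ≟ u ⌋ ∧ ⌊ y ≟ v ⌋) ∨ G x y

ΓStep : ∀ {n} → Perm n × Graph n → Pair n → Perm n × Graph n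
ΓStep {n} (σ , G) (u , v) =
  if edgeConfig {n} σ (evenPt u) (oddPt v)
  then (_·_ {n} (transpose (evenPt u) (oddPt v)) σ , addEdge (u , v) G)
  else (σ , G)

-- Γ(π), iterating over the list L of all pairs in increasing order
-- (L must be a valid total order of all of binom([n],2)).
Γ : ∀ {n} → List (Pair n) → Perm n → Graph n
Γ L π = proj₂ (foldl ΓStep (π , emptyGraph) L)

AllPairs : ∀ {n} → Pair n → Set
AllPairs _ = ⊤

{-# OPTIONS --safe #-}

-- Γ visits the pairs in a valid order, and the invariant is that, when it reaches {u,v}, its permutation
-- is Π(S) for the list S of edges of G not yet visited; in particular no edge of S lies strictly below
-- {u,v} in ⪯. The key lemma (apart-Π): if S is validly ordered, closed under the terrain rule, and has no
-- edge ⪯ {u,v}, then 2u and 2v−1 are not in edge configuration in Π(S). Hence nothing happens when {u,v}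
-- is not an edge. When it is, the edges before it in S share no endpoint with it, so τ({u,v}) moves to the
-- front of Π(S); by the lemma for S without {u,v} and the swap performed by τ({u,v}), the two points are in
-- edge configuration, and multiplying by τ({u,v}) removes {u,v} from S. The lemma itself is proved by
-- following 2u and 2v−1 backwards through the transpositions of Π(S): each path alternates between left and
-- right endpoints without entering the window between u and v, and when both paths have crossed an edge,
-- the terrain rule produces a common later edge from whose two ends they continue in mirrored position.

module Submission where

open import Defs

open import Data.Bool using (Bool; true; false; not; _xor_)
open import Data.Bool.Properties using (not-distribˡ-xor)
open import Data.Fin using (Fin; zero; suc; toℕ; combine; _<_; _≤_; _≟_)
open import Data.Fin.Properties
  using (toℕ-combine; toℕ<n; combine-monoˡ-<; combine-injectiveˡ; combine-injectiveʳ; toℕ-injective;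
         ≤-refl; ≤-reflexive; <-irrefl)
open import Data.Fin.Permutation using (Permutation′; _⟨$⟩ˡ_; _⟨$⟩ʳ_; inverseʳ; transpose; id)
import Data.Fin.Permutation.Components as PC
open import Data.List using (List; []; _∷_; foldr; foldl; filter; allFin; length; lookup)
open import Data.List.Properties using (tabulate-lookup; filter-accept; filter-reject; filter-all)
import Data.List.Membership.DecPropositional as DecMembership
open import Data.List.Membership.Propositional using (_∈_; _∉_)
open import Data.List.Membership.Propositional.Properties using (∈-allFin; ∈-filter⁺; ∈-filter⁻)
open import Data.List.Relation.Unary.All as All using (All; []; _∷_)
open import Data.List.Relation.Unary.AllPairs as AllPairs using ([]; _∷_)
open import Data.List.Relation.Unary.AllPairs.Properties using (tabulate⁺-<) renaming (filter⁺ to sorted-filter⁺)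
open import Data.List.Relation.Unary.Any as Any using (here; there)
open import Data.List.Relation.Unary.Unique.Propositional using (Unique)
open import Data.List.Relation.Unary.Unique.Propositional.Properties using (allFin⁺)
open import Data.Nat as ℕ using (ℕ; _*_; _+_; _%_; _<ᵇ_; _≡ᵇ_)
import Data.Nat.Properties as ℕ
open import Data.Nat.DivMod using ([m+kn]%n≡m%n; m<n⇒m%n≡m)
open import Data.Product using (_×_; _,_; proj₁; proj₂; Σ-syntax)
open import Data.Product.Properties using (≡-dec)
open import Data.Sum as Sum using (_⊎_; inj₁; inj₂)
open import Data.Unit using (tt)
open import Function using (_∘_)
open import Function.Bundles using (Equivalence)
open import Relation.Binary using (tri<; tri≈; tri>)
open import Relation.Binary.PropositionalEquality
open import Relation.Nullary using (¬_; yes; no; Dec; contradiction)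
open import Relation.Nullary.Decidable using (dec-true; dec-false)

private variable
  n m : ℕ

-- Points of [2n] and edge configuration

evenPt-injective : (a b : Fin n) → evenPt a ≡ evenPt b → a ≡ b
evenPt-injective a b = combine-injectiveˡ a _ b _

oddPt-injective : (a b : Fin n) → oddPt a ≡ oddPt b → a ≡ b
oddPt-injective a b = combine-injectiveˡ a _ b _

evenPt≢oddPt : (a b : Fin n) → evenPt a ≢ oddPt b
evenPt≢oddPt a b eq with combine-injectiveʳ a _ b _ eq
... | ()

parity-combine : (a : Fin n) (j : Fin 2) → toℕ (combine a j) % 2 ≡ toℕ j
parity-combine a j = begin
  toℕ (combine a j) % 2        ≡⟨ cong (_% 2) (toℕ-combine a j) ⟩
  (2 * toℕ a + toℕ j) % 2      ≡⟨ cong (_% 2) (ℕ.+-comm (2 * toℕ a) (toℕ j)) ⟩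
  (toℕ j + 2 * toℕ a) % 2      ≡⟨ cong (λ k → (toℕ j + k) % 2) (ℕ.*-comm 2 (toℕ a)) ⟩
  (toℕ j + toℕ a * 2) % 2      ≡⟨ [m+kn]%n≡m%n (toℕ j) (toℕ a) 2 ⟩
  toℕ j % 2                    ≡⟨ m<n⇒m%n≡m (toℕ<n j) ⟩
  toℕ j                        ∎
  where open ≡-Reasoning

oddPt<evenPt : {w z : Fin n} → w ≤ z → oddPt w < evenPt z
oddPt<evenPt {w = w} {z} w≤z = begin-strict
  toℕ (oddPt w)       ≡⟨ toℕ-combine w zero ⟩
  2 * toℕ w + 0       ≤⟨ ℕ.+-monoˡ-≤ 0 (ℕ.*-monoʳ-≤ 2 w≤z) ⟩
  2 * toℕ z + 0       <⟨ ℕ.+-monoʳ-< (2 * toℕ z) ℕ.z<s ⟩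
  2 * toℕ z + 1       ≡⟨ toℕ-combine z (suc zero) ⟨
  toℕ (evenPt z)      ∎
  where open ℕ.≤-Reasoning

-- edgeConfig σ i j unfolds to edgeConfigAt (σ ⟨$⟩ˡ i) (σ ⟨$⟩ˡ j).
edgeConfigAt : Fin m → Fin m → Bool
edgeConfigAt p q = not ((toℕ p <ᵇ toℕ q) xor (toℕ p % 2 ≡ᵇ toℕ q % 2))

Apart : Fin m → Fin m → Set
Apart p q = edgeConfigAt p q ≡ false

apart-sameParity : {p q : Fin m} → toℕ p % 2 ≡ toℕ q % 2 → q < p → Apart p q
apart-sameParity {p = p} {q} par q<p
  rewrite dec-false (toℕ p ℕ.<? toℕ q) (ℕ.<⇒≯ q<p) | dec-true (toℕ p % 2 ℕ.≟ toℕ q % 2) par = refl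

apart-diffParity : {p q : Fin m} → toℕ p % 2 ≢ toℕ q % 2 → p < q → Apart p q
apart-diffParity {p = p} {q} par p<q
  rewrite dec-true (toℕ p ℕ.<? toℕ q) p<q | dec-false (toℕ p % 2 ℕ.≟ toℕ q % 2) par = refl

<ᵇ-flip : {i j : ℕ} → i ≢ j → (j <ᵇ i) ≡ not (i <ᵇ j)
<ᵇ-flip {i} {j} i≢j with ℕ.<-cmp i j
... | tri< i<j _ _ rewrite dec-true (i ℕ.<? j) i<j | dec-false (j ℕ.<? i) (ℕ.<⇒≯ i<j) = refl
... | tri≈ _ i≡j _ = contradiction i≡j i≢j
... | tri> _ _ j<i rewrite dec-false (i ℕ.<? j) (ℕ.<⇒≯ j<i) | dec-true (j ℕ.<? i) j<i = refl

≡ᵇ-sym : (i j : ℕ) → (i ≡ᵇ j) ≡ (j ≡ᵇ i)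
≡ᵇ-sym i j with i ℕ.≟ j
... | yes i≡j rewrite dec-true (i ℕ.≟ j) i≡j | dec-true (j ℕ.≟ i) (sym i≡j) = refl
... | no i≢j rewrite dec-false (i ℕ.≟ j) i≢j | dec-false (j ℕ.≟ i) (i≢j ∘ sym) = refl

edgeConfigAt-flip : {p q : Fin m} → p ≢ q → edgeConfigAt q p ≡ not (edgeConfigAt p q)
edgeConfigAt-flip {p = p} {q} p≢q = begin
  not ((toℕ q <ᵇ toℕ p) xor (toℕ q % 2 ≡ᵇ toℕ p % 2))
    ≡⟨ cong₂ (λ x y → not (x xor y)) (<ᵇ-flip (p≢q ∘ toℕ-injective)) (≡ᵇ-sym (toℕ q % 2) (toℕ p % 2)) ⟩
  not (not (toℕ p <ᵇ toℕ q) xor (toℕ p % 2 ≡ᵇ toℕ q % 2))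
    ≡⟨ cong not (not-distribˡ-xor (toℕ p <ᵇ toℕ q) _) ⟨
  not (edgeConfigAt p q)  ∎
  where open ≡-Reasoning

apart-oddPt-oddPt : {w₁ w₂ : Fin n} → w₂ < w₁ → Apart (oddPt w₁) (oddPt w₂)
apart-oddPt-oddPt {w₁ = w₁} {w₂} w₂<w₁ =
  apart-sameParity (trans (parity-combine w₁ zero) (sym (parity-combine w₂ zero))) (combine-monoˡ-< zero zero w₂<w₁)

apart-evenPt-evenPt : {z₁ z₂ : Fin n} → z₂ < z₁ → Apart (evenPt z₁) (evenPt z₂)
apart-evenPt-evenPt {z₁ = z₁} {z₂} z₂<z₁ =
  apart-sameParity (trans (parity-combine z₁ (suc zero)) (sym (parity-combine z₂ (suc zero))))
                   (combine-monoˡ-< (suc zero) (suc zero) z₂<z₁)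

apart-oddPt-evenPt : {w z : Fin n} → w ≤ z → Apart (oddPt w) (evenPt z)
apart-oddPt-evenPt {w = w} {z} w≤z =
  apart-diffParity (λ par → ℕ.0≢1+n (trans (sym (parity-combine w zero)) (trans par (parity-combine z (suc zero)))))
                   (oddPt<evenPt w≤z)

-- Transpositions and the permutations τ(e), π₀ and Π(L)

module _ {i j : Fin m} where

  transpose-matchˡ : PC.transpose i j i ≡ j
  transpose-matchˡ rewrite dec-true (i ≟ i) refl = refl

  transpose-matchʳ : PC.transpose i j j ≡ i
  transpose-matchʳ with j ≟ i
  ... | yes j≡i = j≡i
  ... | no _ rewrite dec-true (j ≟ j) refl = refl

  transpose-other : {k : Fin m} → k ≢ i → k ≢ j → PC.transpose i j k ≡ k
  transpose-other {k} k≢i k≢j rewrite dec-false (k ≟ i) k≢i | dec-false (k ≟ j) k≢j = refl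

  transpose-involutive : (k : Fin m) → PC.transpose i j (PC.transpose i j k) ≡ k
  transpose-involutive k = by-cases (k ≟ i) (k ≟ j)
    where
    T = PC.transpose i j
    by-cases : Dec (k ≡ i) → Dec (k ≡ j) → T (T k) ≡ k
    by-cases (yes refl) _ = trans (cong T transpose-matchˡ) transpose-matchʳ
    by-cases (no _) (yes refl) = trans (cong T transpose-matchʳ) transpose-matchˡ
    by-cases (no k≢i) (no k≢j) = trans (cong T (transpose-other k≢i k≢j)) (transpose-other k≢i k≢j)

transpose-comm : {i j k l : Fin m} → i ≢ k → i ≢ l → j ≢ k → j ≢ l → (x : Fin m) →
  PC.transpose i j (PC.transpose k l x) ≡ PC.transpose k l (PC.transpose i j x)
transpose-comm {i = i} {j} {k} {l} i≢k i≢l j≢k j≢l x = by-cases (x ≟ i) (x ≟ j) (x ≟ k) (x ≟ l)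
  where
  T = PC.transpose i j
  U = PC.transpose k l
  by-cases : Dec (x ≡ i) → Dec (x ≡ j) → Dec (x ≡ k) → Dec (x ≡ l) → T (U x) ≡ U (T x)
  by-cases (yes refl) _ _ _ = begin
    T (U x)  ≡⟨ cong T (transpose-other i≢k i≢l) ⟩
    T x      ≡⟨ transpose-matchˡ {i = i} {j = j} ⟩
    j        ≡⟨ transpose-other j≢k j≢l ⟨
    U j      ≡⟨ cong U (transpose-matchˡ {i = i} {j = j}) ⟨
    U (T x)  ∎
    where open ≡-Reasoning
  by-cases (no _) (yes refl) _ _ = begin
    T (U x)  ≡⟨ cong T (transpose-other j≢k j≢l) ⟩
    T x      ≡⟨ transpose-matchʳ {i = i} {j = j} ⟩
    i        ≡⟨ transpose-other i≢k i≢l ⟨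
    U i      ≡⟨ cong U (transpose-matchʳ {i = i} {j = j}) ⟨
    U (T x)  ∎
    where open ≡-Reasoning
  by-cases (no x≢i) (no x≢j) (yes refl) _ = begin
    T (U x)  ≡⟨ cong T (transpose-matchˡ {i = k} {j = l}) ⟩
    T l      ≡⟨ transpose-other (i≢l ∘ sym) (j≢l ∘ sym) ⟩
    l        ≡⟨ transpose-matchˡ {i = k} {j = l} ⟨
    U x      ≡⟨ cong U (transpose-other x≢i x≢j) ⟨
    U (T x)  ∎
    where open ≡-Reasoning
  by-cases (no x≢i) (no x≢j) (no _) (yes refl) = begin
    T (U x)  ≡⟨ cong T (transpose-matchʳ {i = k} {j = l}) ⟩
    T k      ≡⟨ transpose-other (i≢k ∘ sym) (j≢k ∘ sym) ⟩
    k        ≡⟨ transpose-matchʳ {i = k} {j = l} ⟨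
    U x      ≡⟨ cong U (transpose-other x≢i x≢j) ⟨
    U (T x)  ∎
    where open ≡-Reasoning
  by-cases (no x≢i) (no x≢j) (no x≢k) (no x≢l) = begin
    T (U x)  ≡⟨ cong T (transpose-other x≢k x≢l) ⟩
    T x      ≡⟨ transpose-other x≢i x≢j ⟩
    x        ≡⟨ transpose-other x≢k x≢l ⟨
    U x      ≡⟨ cong U (transpose-other x≢i x≢j) ⟨
    U (T x)  ∎
    where open ≡-Reasoning

⟨$⟩ˡ-injective : (π : Permutation′ m) {x y : Fin m} → π ⟨$⟩ˡ x ≡ π ⟨$⟩ˡ y → x ≡ y
⟨$⟩ˡ-injective π eq = trans (sym (inverseʳ π)) (trans (cong (π ⟨$⟩ʳ_) eq) (inverseʳ π))

-- Π⁻¹ (e ∷ L) x reduces to Π⁻¹ L (τ e ⟨$⟩ˡ x): a point is traced through L from the front, then through π₀.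
Π⁻¹ : List (Pair n) → Fin (n * 2) → Fin (n * 2)
Π⁻¹ L x = Π L ⟨$⟩ˡ x

module _ {a b : Fin n} where

  τ-evenPt : τ (a , b) ⟨$⟩ˡ evenPt a ≡ oddPt b
  τ-evenPt = transpose-matchʳ {i = oddPt b} {j = evenPt a}

  τ-oddPt : τ (a , b) ⟨$⟩ˡ oddPt b ≡ evenPt a
  τ-oddPt = transpose-matchˡ {i = oddPt b} {j = evenPt a}

  τ-evenPt-other : {x : Fin n} → a ≢ x → τ (a , b) ⟨$⟩ˡ evenPt x ≡ evenPt x
  τ-evenPt-other {x} a≢x = transpose-other (evenPt≢oddPt x b) (a≢x ∘ sym ∘ evenPt-injective x a)

  τ-oddPt-other : {y : Fin n} → b ≢ y → τ (a , b) ⟨$⟩ˡ oddPt y ≡ oddPt y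
  τ-oddPt-other {y} b≢y = transpose-other (b≢y ∘ sym ∘ oddPt-injective y b) (evenPt≢oddPt a y ∘ sym)

τ-involutive : (e : Pair n) (x : Fin (n * 2)) → τ e ⟨$⟩ˡ (τ e ⟨$⟩ˡ x) ≡ x
τ-involutive e x = transpose-involutive x

τ-comm : {c e : Pair n} → proj₁ c ≢ proj₁ e → proj₂ c ≢ proj₂ e → (x : Fin (n * 2)) →
  τ c ⟨$⟩ˡ (τ e ⟨$⟩ˡ x) ≡ τ e ⟨$⟩ˡ (τ c ⟨$⟩ˡ x)
τ-comm {c = a , b} {a′ , b′} a≢a′ b≢b′ =
  transpose-comm (b≢b′ ∘ oddPt-injective b b′) (evenPt≢oddPt a′ b ∘ sym) (evenPt≢oddPt a b′)
                 (a≢a′ ∘ evenPt-injective a a′)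

swapPairs : List (Fin n) → Perm n
swapPairs {n} = foldr (λ k acc → _·_ {n} (transpose (oddPt k) (evenPt k)) acc) id

module _ {k a : Fin n} (k≢a : k ≢ a) where

  swapPair-evenPt-other : PC.transpose (evenPt k) (oddPt k) (evenPt a) ≡ evenPt a
  swapPair-evenPt-other = transpose-other (k≢a ∘ sym ∘ evenPt-injective a k) (evenPt≢oddPt a k)

  swapPair-oddPt-other : PC.transpose (evenPt k) (oddPt k) (oddPt a) ≡ oddPt a
  swapPair-oddPt-other = transpose-other (evenPt≢oddPt k a ∘ sym) (k≢a ∘ sym ∘ oddPt-injective a k)

swapPairs-∉ : {a : Fin n} (ks : List (Fin n)) → All (_≢ a) ks →
  swapPairs ks ⟨$⟩ˡ evenPt a ≡ evenPt a × swapPairs ks ⟨$⟩ˡ oddPt a ≡ oddPt a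
swapPairs-∉ [] [] = refl , refl
swapPairs-∉ (k ∷ ks) (k≢a ∷ ks∌a)
  rewrite swapPair-evenPt-other k≢a | swapPair-oddPt-other k≢a = swapPairs-∉ ks ks∌a

swapPairs-∈ : {a : Fin n} (ks : List (Fin n)) → Unique ks → a ∈ ks →
  swapPairs ks ⟨$⟩ˡ evenPt a ≡ oddPt a × swapPairs ks ⟨$⟩ˡ oddPt a ≡ evenPt a
swapPairs-∈ {a = a} (a ∷ ks) (a∉ks ∷ _) (here refl)
  rewrite transpose-matchˡ {i = evenPt a} {oddPt a} | transpose-matchʳ {i = evenPt a} {oddPt a}
  = let fixes-evenPt , fixes-oddPt = swapPairs-∉ ks (All.map (_∘ sym) a∉ks) in fixes-oddPt , fixes-evenPt
swapPairs-∈ (k ∷ ks) (k∉ks ∷ ks!) (there a∈ks)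
  rewrite swapPair-evenPt-other (All.lookup k∉ks a∈ks) | swapPair-oddPt-other (All.lookup k∉ks a∈ks)
  = swapPairs-∈ ks ks! a∈ks

π₀-evenPt : (a : Fin n) → π₀ n ⟨$⟩ˡ evenPt a ≡ oddPt a
π₀-evenPt {n} a = proj₁ (swapPairs-∈ (allFin n) (allFin⁺ n) (∈-allFin a))

π₀-oddPt : (a : Fin n) → π₀ n ⟨$⟩ˡ oddPt a ≡ evenPt a
π₀-oddPt {n} a = proj₂ (swapPairs-∈ (allFin n) (allFin⁺ n) (∈-allFin a))

-- Valid orderings

Sorted : List (Pair n) → Set
Sorted = AllPairs.AllPairs (λ e c → ¬ (c ⪯ e))

sorted-lookup : (L : List (Pair n)) →
  (∀ (i j : Fin (length L)) → lookup L i ⪯ lookup L j → toℕ i ℕ.≤ toℕ j) → Sorted L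
sorted-lookup L increasing =
  subst Sorted (tabulate-lookup L) (tabulate⁺-< λ {i} {j} i<j j⪯i → ℕ.<⇒≱ i<j (increasing j i j⪯i))

module _ {S : Pair n → Set} {L : List (Pair n)} (valid : ValidOrdering S L) where

  validOrdering-sorted : Sorted L
  validOrdering-sorted = sorted-lookup L (proj₂ (proj₂ (proj₂ valid)))

  validOrdering-ordered : {c : Pair n} → c ∈ L → proj₁ c < proj₂ c
  validOrdering-ordered = All.lookup (proj₁ valid)

  validOrdering-sound : {c : Pair n} → c ∈ L → S c
  validOrdering-sound {c} c∈L =
    Equivalence.to (proj₁ (proj₂ (proj₂ valid)) (proj₁ c) (proj₂ c) (validOrdering-ordered c∈L)) c∈L

  validOrdering-complete : {u v : Fin n} → u < v → S (u , v) → (u , v) ∈ L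
  validOrdering-complete {u} {v} u<v = Equivalence.from (proj₁ (proj₂ (proj₂ valid)) u v u<v)

⪯-refl : (e : Pair n) → e ⪯ e
⪯-refl e = ≤-refl , ≤-refl

module _ {c e : Pair n} (c⋠e : ¬ (c ⪯ e)) where

  ⋠-sameLeft : proj₁ c ≡ proj₁ e → proj₂ e < proj₂ c
  ⋠-sameLeft c₁≡e₁ = ℕ.≰⇒> λ c₂≤e₂ → c⋠e (≤-reflexive (sym c₁≡e₁) , c₂≤e₂)

  ⋠-sameRight : proj₂ c ≡ proj₂ e → proj₁ c < proj₁ e
  ⋠-sameRight c₂≡e₂ = ℕ.≰⇒> λ e₁≤c₁ → c⋠e (e₁≤c₁ , ≤-reflexive c₂≡e₂)

  ⋠⋡-distinctEnds : ¬ (e ⪯ c) → proj₁ c ≢ proj₁ e × proj₂ c ≢ proj₂ e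
  ⋠⋡-distinctEnds e⋠c =
    (λ c₁≡e₁ → e⋠c (≤-reflexive c₁≡e₁ , ℕ.<⇒≤ (⋠-sameLeft c₁≡e₁))) ,
    (λ c₂≡e₂ → e⋠c (ℕ.<⇒≤ (⋠-sameRight c₂≡e₂) , ≤-reflexive (sym c₂≡e₂)))

ExitsRightOf : List (Pair n) → Fin n → Fin n → Set
ExitsRightOf S x y = ∀ {c} → c ∈ S → proj₁ c ≡ x → y < proj₂ c

EntersLeftOf : List (Pair n) → Fin n → Fin n → Set
EntersLeftOf S y x = ∀ {c} → c ∈ S → proj₂ c ≡ y → proj₁ c < x

module _ {a b : Fin n} {S : List (Pair n)} (sorted : Sorted ((a , b) ∷ S)) where

  sorted-exitsRightOf : ExitsRightOf S a b
  sorted-exitsRightOf c∈S = ⋠-sameLeft (All.lookup (AllPairs.head sorted) c∈S)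

  sorted-entersLeftOf : EntersLeftOf S b a
  sorted-entersLeftOf c∈S = ⋠-sameRight (All.lookup (AllPairs.head sorted) c∈S)

  sorted-sameLeft : {b′ : Fin n} → (a , b′) ∈ (a , b) ∷ S → b ≤ b′
  sorted-sameLeft (here refl) = ≤-refl
  sorted-sameLeft (there ab′∈S) = ℕ.<⇒≤ (sorted-exitsRightOf ab′∈S refl)

  sorted-sameRight : {a′ : Fin n} → (a′ , b) ∈ (a , b) ∷ S → a′ ≤ a
  sorted-sameRight (here refl) = ≤-refl
  sorted-sameRight (there a′b∈S) = ℕ.<⇒≤ (sorted-entersLeftOf a′b∈S refl)

-- The suffixes of a validly ordered list U that the paths below run through.
record UpperSegment (U S : List (Pair n)) : Set where
  field
    sorted : Sorted S
    ⊆U : ∀ {c} → c ∈ S → c ∈ U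
    upward : ∀ {h c} → h ∈ S → c ∈ U → h ⪯ c → c ∈ S

open UpperSegment

module _ {U : List (Pair n)} where

  upperSegment-refl : Sorted U → UpperSegment U U
  upperSegment-refl sortedU = record { sorted = sortedU ; ⊆U = λ c∈U → c∈U ; upward = λ _ c∈U _ → c∈U }

  upperSegment-above : {e c : Pair n} {S : List (Pair n)} → UpperSegment U (e ∷ S) →
    c ∈ U → e ⪯ c → c ≢ e → c ∈ S
  upperSegment-above seg c∈U e⪯c c≢e = Any.tail c≢e (upward seg (here refl) c∈U e⪯c)

  upperSegment-tail : {e : Pair n} {S : List (Pair n)} → UpperSegment U (e ∷ S) → UpperSegment U S
  upperSegment-tail {e} seg = record
    { sorted = AllPairs.tail (sorted seg)
    ; ⊆U = ⊆U seg ∘ there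
    ; upward = λ {h} h∈S c∈U h⪯c → Any.tail (λ { refl → All.lookup (AllPairs.head (sorted seg)) h∈S h⪯c })
                                            (upward seg (there h∈S) c∈U h⪯c)
    }

-- Following points through Π(S)⁻¹

OddPtAtMost OddPtBelow EvenPtAtLeast EvenPtAbove : Fin n → Fin (n * 2) → Set
OddPtAtMost {n} x q = Σ[ w ∈ Fin n ] w ≤ x × q ≡ oddPt w
OddPtBelow {n} x q = Σ[ w ∈ Fin n ] w < x × q ≡ oddPt w
EvenPtAtLeast {n} y q = Σ[ z ∈ Fin n ] y ≤ z × q ≡ evenPt z
EvenPtAbove {n} y q = Σ[ z ∈ Fin n ] y < z × q ≡ evenPt z

module _ {q : Fin (n * 2)} where

  oddPtBelow⇒atMost : {x : Fin n} → OddPtBelow x q → OddPtAtMost x q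
  oddPtBelow⇒atMost (w , w<x , eq) = w , ℕ.<⇒≤ w<x , eq

  oddPtAtMost-below : {x x′ : Fin n} → x < x′ → OddPtAtMost x q → OddPtBelow x′ q
  oddPtAtMost-below x<x′ (w , w≤x , eq) = w , ℕ.≤-<-trans w≤x x<x′ , eq

  evenPtAbove⇒atLeast : {y : Fin n} → EvenPtAbove y q → EvenPtAtLeast y q
  evenPtAbove⇒atLeast (z , y<z , eq) = z , ℕ.<⇒≤ y<z , eq

  evenPtAtLeast-above : {y y′ : Fin n} → y < y′ → EvenPtAtLeast y′ q → EvenPtAbove y q
  evenPtAtLeast-above y<y′ (z , y′≤z , eq) = z , ℕ.<-≤-trans y<y′ y′≤z , eq

escape-evenPt : (S : List (Pair n)) → Sorted S → {x y : Fin n} → ExitsRightOf S x y →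
  OddPtAtMost x (Π⁻¹ S (evenPt x)) ⊎ EvenPtAbove y (Π⁻¹ S (evenPt x))
escape-oddPt : (S : List (Pair n)) → Sorted S → {y x : Fin n} → EntersLeftOf S y x →
  OddPtBelow x (Π⁻¹ S (oddPt y)) ⊎ EvenPtAtLeast y (Π⁻¹ S (oddPt y))

escape-evenPt [] [] {x} _ = inj₁ (x , ≤-refl , π₀-evenPt x)
escape-evenPt ((a , b) ∷ S) sorted {x} exits with a ≟ x
... | yes refl rewrite τ-evenPt {a = a} {b} =
  Sum.map oddPtBelow⇒atMost (evenPtAtLeast-above (exits (here refl) refl))
          (escape-oddPt S (AllPairs.tail sorted) (sorted-entersLeftOf sorted))
... | no a≢x rewrite τ-evenPt-other {b = b} a≢x = escape-evenPt S (AllPairs.tail sorted) (exits ∘ there)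

escape-oddPt [] [] {y} _ = inj₂ (y , ≤-refl , π₀-oddPt y)
escape-oddPt ((a , b) ∷ S) sorted {y} enters with b ≟ y
... | yes refl rewrite τ-oddPt {a = a} {b} =
  Sum.map (oddPtAtMost-below (enters (here refl) refl)) evenPtAbove⇒atLeast
          (escape-evenPt S (AllPairs.tail sorted) (sorted-exitsRightOf sorted))
... | no b≢y rewrite τ-oddPt-other {a = a} b≢y = escape-oddPt S (AllPairs.tail sorted) (enters ∘ there)

TerrainClosed : List (Pair n) → Set
TerrainClosed {n} U = ∀ (a b c d : Fin n) → a < b → b < c → c < d →
  (a , c) ∈ U → (b , d) ∈ U → (a , d) ∈ U

-- The four lemmas follow the two paths in lockstep, indexed by the parities of their current points.
-- Once both have crossed an edge, (x₁ , b) and (a , y₂), the terrain rule puts (a , b) into both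
-- remaining lists, and the paths continue from odd b and even a.
module _ {U : List (Pair n)} (terrain : TerrainClosed U) where

  Π⁻¹-apart-evenPt-oddPt : (S₁ S₂ : List (Pair n)) → UpperSegment U S₁ → UpperSegment U S₂ →
    {x₁ x₂ y₁ y₂ : Fin n} → x₂ ≤ x₁ → x₁ < y₂ → y₂ ≤ y₁ →
    ExitsRightOf S₁ x₁ y₁ → EntersLeftOf S₂ y₂ x₂ →
    Apart (Π⁻¹ S₁ (evenPt x₁)) (Π⁻¹ S₂ (oddPt y₂))
  Π⁻¹-apart-oddPt-oddPt : (S₁ S₂ : List (Pair n)) {x₁ b : Fin n} →
    UpperSegment U ((x₁ , b) ∷ S₁) → UpperSegment U S₂ →
    {x₂ y₂ : Fin n} → x₂ ≤ x₁ → x₁ < y₂ → y₂ < b → EntersLeftOf S₂ y₂ x₂ →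
    Apart (Π⁻¹ S₁ (oddPt b)) (Π⁻¹ S₂ (oddPt y₂))
  Π⁻¹-apart-oddPt-evenPt : (S₁ S₂ : List (Pair n)) → UpperSegment U S₁ → UpperSegment U S₂ →
    {x₁ x₂ y₁ y₂ : Fin n} → x₂ < x₁ → x₁ < y₂ →
    (x₂ , y₁) ∈ S₁ → (x₂ , y₁) ∈ S₂ → EntersLeftOf S₁ y₁ x₁ → ExitsRightOf S₂ x₂ y₂ →
    Apart (Π⁻¹ S₁ (oddPt y₁)) (Π⁻¹ S₂ (evenPt x₂))
  Π⁻¹-apart-evenPt-evenPt : (S₁ S₂ : List (Pair n)) {a y₁ : Fin n} →
    UpperSegment U ((a , y₁) ∷ S₁) → UpperSegment U S₂ →
    {x₂ y₂ : Fin n} → x₂ ≤ a → a < y₂ → (x₂ , y₁) ∈ S₂ → ExitsRightOf S₂ x₂ y₂ →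
    Apart (Π⁻¹ S₁ (evenPt a)) (Π⁻¹ S₂ (evenPt x₂))

  Π⁻¹-apart-evenPt-oddPt [] S₂ _ seg₂ {x₁} x₂≤x₁ x₁<y₂ _ _ enters
    rewrite π₀-evenPt x₁ with escape-oddPt S₂ (sorted seg₂) enters
  ... | inj₁ (w , w<x₂ , eq) = subst (Apart _) (sym eq) (apart-oddPt-oddPt (ℕ.<-≤-trans w<x₂ x₂≤x₁))
  ... | inj₂ (z , y₂≤z , eq) = subst (Apart _) (sym eq) (apart-oddPt-evenPt (ℕ.<⇒≤ (ℕ.<-≤-trans x₁<y₂ y₂≤z)))
  Π⁻¹-apart-evenPt-oddPt ((a , b) ∷ S₁) S₂ seg₁ seg₂ {x₁} x₂≤x₁ x₁<y₂ y₂≤y₁ exits enters with a ≟ x₁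
  ... | yes refl rewrite τ-evenPt {a = a} {b} =
    Π⁻¹-apart-oddPt-oddPt S₁ S₂ seg₁ seg₂ x₂≤x₁ x₁<y₂ (ℕ.≤-<-trans y₂≤y₁ (exits (here refl) refl)) enters
  ... | no a≢x₁ rewrite τ-evenPt-other {b = b} a≢x₁ =
    Π⁻¹-apart-evenPt-oddPt S₁ S₂ (upperSegment-tail seg₁) seg₂ x₂≤x₁ x₁<y₂ y₂≤y₁ (exits ∘ there) enters

  Π⁻¹-apart-oddPt-oddPt S₁ [] seg₁ _ {y₂ = y₂} _ x₁<y₂ y₂<b _
    rewrite π₀-oddPt y₂ with escape-oddPt S₁ (sorted (upperSegment-tail seg₁)) (sorted-entersLeftOf (sorted seg₁))
  ... | inj₁ (w , w<x₁ , eq) = subst (λ p → Apart p (evenPt y₂)) (sym eq) (apart-oddPt-evenPt (ℕ.<⇒≤ (ℕ.<-trans w<x₁ x₁<y₂)))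
  ... | inj₂ (z , b≤z , eq) = subst (λ p → Apart p (evenPt y₂)) (sym eq) (apart-evenPt-evenPt (ℕ.<-≤-trans y₂<b b≤z))
  Π⁻¹-apart-oddPt-oddPt S₁ ((a , c) ∷ S₂) {x₁} {b} seg₁ seg₂ {y₂ = y₂} x₂≤x₁ x₁<y₂ y₂<b enters with c ≟ y₂
  ... | no c≢y₂ rewrite τ-oddPt-other {a = a} c≢y₂ =
    Π⁻¹-apart-oddPt-oddPt S₁ S₂ seg₁ (upperSegment-tail seg₂) x₂≤x₁ x₁<y₂ y₂<b (enters ∘ there)
  ... | yes refl rewrite τ-oddPt {a = a} {c} =
    Π⁻¹-apart-oddPt-evenPt S₁ S₂ (upperSegment-tail seg₁) (upperSegment-tail seg₂) a<x₁ x₁<y₂ ab∈S₁ ab∈S₂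
                       (sorted-entersLeftOf (sorted seg₁)) (sorted-exitsRightOf (sorted seg₂))
    where
    a<x₁ : a < x₁
    a<x₁ = ℕ.<-≤-trans (enters (here refl) refl) x₂≤x₁
    ab∈U : (a , b) ∈ U
    ab∈U = terrain a x₁ c b a<x₁ x₁<y₂ y₂<b (⊆U seg₂ (here refl)) (⊆U seg₁ (here refl))
    ab∈S₁ : (a , b) ∈ S₁
    ab∈S₁ = upperSegment-above seg₁ ab∈U (ℕ.<⇒≤ a<x₁ , ≤-refl) λ ab≡x₁b → <-irrefl (cong proj₁ ab≡x₁b) a<x₁
    ab∈S₂ : (a , b) ∈ S₂
    ab∈S₂ = upperSegment-above seg₂ ab∈U (≤-refl , ℕ.<⇒≤ y₂<b) λ ab≡ac → <-irrefl (sym (cong proj₂ ab≡ac)) y₂<b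

  Π⁻¹-apart-oddPt-evenPt [] S₂ _ _ _ _ () _ _ _
  Π⁻¹-apart-oddPt-evenPt ((a , c) ∷ S₁) S₂ seg₁ seg₂ {y₁ = y₁} x₂<x₁ x₁<y₂ x₂y₁∈S₁ x₂y₁∈S₂ enters exits with c ≟ y₁
  ... | no c≢y₁ rewrite τ-oddPt-other {a = a} c≢y₁ =
    Π⁻¹-apart-oddPt-evenPt S₁ S₂ (upperSegment-tail seg₁) seg₂ x₂<x₁ x₁<y₂
                       (Any.tail (c≢y₁ ∘ sym ∘ cong proj₂) x₂y₁∈S₁) x₂y₁∈S₂ (enters ∘ there) exits
  ... | yes refl rewrite τ-oddPt {a = a} {c} =
    Π⁻¹-apart-evenPt-evenPt S₁ S₂ seg₁ seg₂ (sorted-sameRight (sorted seg₁) x₂y₁∈S₁)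
                        (ℕ.<-trans (enters (here refl) refl) x₁<y₂) x₂y₁∈S₂ exits

  Π⁻¹-apart-evenPt-evenPt S₁ [] _ _ _ _ () _
  Π⁻¹-apart-evenPt-evenPt S₁ ((c , b′) ∷ S₂) {a} {y₁} seg₁ seg₂ {x₂} x₂≤a a<y₂ x₂y₁∈S₂ exits with c ≟ x₂
  ... | no c≢x₂ rewrite τ-evenPt-other {b = b′} c≢x₂ =
    Π⁻¹-apart-evenPt-evenPt S₁ S₂ seg₁ (upperSegment-tail seg₂) x₂≤a a<y₂
                        (Any.tail (c≢x₂ ∘ sym ∘ cong proj₁) x₂y₁∈S₂) (exits ∘ there)
  ... | yes refl rewrite τ-evenPt {a = c} {b′} =
    Π⁻¹-apart-evenPt-oddPt S₁ S₂ (upperSegment-tail seg₁) (upperSegment-tail seg₂) x₂≤a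
                       (ℕ.<-trans a<y₂ (exits (here refl) refl)) (sorted-sameLeft (sorted seg₂) x₂y₁∈S₂)
                       (sorted-exitsRightOf (sorted seg₁)) (sorted-entersLeftOf (sorted seg₂))

  apart-Π : Sorted U → {u v : Fin n} → u < v → (∀ {c} → c ∈ U → ¬ (c ⪯ (u , v))) →
    Apart (Π⁻¹ U (evenPt u)) (Π⁻¹ U (oddPt v))
  apart-Π sortedU u<v nothingBelow =
    Π⁻¹-apart-evenPt-oddPt U U (upperSegment-refl sortedU) (upperSegment-refl sortedU) ≤-refl u<v ≤-refl
                       (⋠-sameLeft ∘ nothingBelow) (⋠-sameRight ∘ nothingBelow)

-- Removing an edge from Π

_≟ₚ_ : (c e : Pair n) → Dec (c ≡ e)
_≟ₚ_ = ≡-dec _≟_ _≟_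

infix 4 _∈?_
_∈?_ : (c : Pair n) (R : List (Pair n)) → Dec (c ∈ R)
c ∈? R = DecMembership._∈?_ _≟ₚ_ c R

module _ {e : Pair n} {R : List (Pair n)} where

  filter-∈?-fresh : (L : List (Pair n)) → All (_≢ e) L → filter (_∈? e ∷ R) L ≡ filter (_∈? R) L
  filter-∈?-fresh [] [] = refl
  filter-∈?-fresh (c ∷ L) (c≢e ∷ L∌e) = by-cases (c ∈? R)
    where
    by-cases : Dec (c ∈ R) → filter (_∈? e ∷ R) (c ∷ L) ≡ filter (_∈? R) (c ∷ L)
    by-cases (yes c∈R) = begin
      filter (_∈? e ∷ R) (c ∷ L)  ≡⟨ filter-accept (_∈? e ∷ R) (there c∈R) ⟩
      c ∷ filter (_∈? e ∷ R) L    ≡⟨ cong (c ∷_) (filter-∈?-fresh L L∌e) ⟩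
      c ∷ filter (_∈? R) L        ≡⟨ filter-accept (_∈? R) c∈R ⟨
      filter (_∈? R) (c ∷ L)      ∎
      where open ≡-Reasoning
    by-cases (no c∉R) = begin
      filter (_∈? e ∷ R) (c ∷ L)  ≡⟨ filter-reject (_∈? e ∷ R) (λ { (here c≡e) → c≢e c≡e ; (there c∈R) → c∉R c∈R }) ⟩
      filter (_∈? e ∷ R) L        ≡⟨ filter-∈?-fresh L L∌e ⟩
      filter (_∈? R) L            ≡⟨ filter-reject (_∈? R) c∉R ⟨
      filter (_∈? R) (c ∷ L)      ∎
      where open ≡-Reasoning

  -- Edges listed before e in L that survive in R share no endpoint with e, so τ(e) commutes past them.
  Π⁻¹-remove : (L : List (Pair n)) → Sorted L → e ∈ L → (∀ {c} → c ∈ R → ¬ (c ⪯ e)) →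
    (x : Fin (n * 2)) → Π⁻¹ (filter (_∈? e ∷ R) L) (τ e ⟨$⟩ˡ x) ≡ Π⁻¹ (filter (_∈? R) L) x
  Π⁻¹-remove (e ∷ L) (e⋡L ∷ _) (here refl) R⋠e x = begin
    Π⁻¹ (filter (_∈? e ∷ R) (e ∷ L)) (τ e ⟨$⟩ˡ x)  ≡⟨ cong (λ K → Π⁻¹ K (τ e ⟨$⟩ˡ x)) (filter-accept (_∈? e ∷ R) (here refl)) ⟩
    Π⁻¹ (filter (_∈? e ∷ R) L) (τ e ⟨$⟩ˡ (τ e ⟨$⟩ˡ x)) ≡⟨ cong (Π⁻¹ (filter (_∈? e ∷ R) L)) (τ-involutive e x) ⟩
    Π⁻¹ (filter (_∈? e ∷ R) L) x                  ≡⟨ cong (λ K → Π⁻¹ K x) (filter-∈?-fresh L (All.map ⋠⇒≢ e⋡L)) ⟩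
    Π⁻¹ (filter (_∈? R) L) x                      ≡⟨ cong (λ K → Π⁻¹ K x) (filter-reject (_∈? R) (λ e∈R → R⋠e e∈R (⪯-refl e))) ⟨
    Π⁻¹ (filter (_∈? R) (e ∷ L)) x                ∎
    where
    open ≡-Reasoning
    ⋠⇒≢ : {c : Pair n} → ¬ (c ⪯ e) → c ≢ e
    ⋠⇒≢ c⋠e refl = c⋠e (⪯-refl e)
  Π⁻¹-remove (c ∷ L) (c⋡L ∷ sortedL) (there e∈L) R⋠e x = by-cases (c ∈? R)
    where
    open ≡-Reasoning
    by-cases : Dec (c ∈ R) → Π⁻¹ (filter (_∈? e ∷ R) (c ∷ L)) (τ e ⟨$⟩ˡ x) ≡ Π⁻¹ (filter (_∈? R) (c ∷ L)) x
    by-cases (yes c∈R) = begin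
      Π⁻¹ (filter (_∈? e ∷ R) (c ∷ L)) (τ e ⟨$⟩ˡ x)   ≡⟨ cong (λ K → Π⁻¹ K (τ e ⟨$⟩ˡ x)) (filter-accept (_∈? e ∷ R) (there c∈R)) ⟩
      Π⁻¹ (filter (_∈? e ∷ R) L) (τ c ⟨$⟩ˡ (τ e ⟨$⟩ˡ x)) ≡⟨ cong (Π⁻¹ (filter (_∈? e ∷ R) L)) (τ-comm c₁≢e₁ c₂≢e₂ x) ⟩
      Π⁻¹ (filter (_∈? e ∷ R) L) (τ e ⟨$⟩ˡ (τ c ⟨$⟩ˡ x)) ≡⟨ Π⁻¹-remove L sortedL e∈L R⋠e (τ c ⟨$⟩ˡ x) ⟩
      Π⁻¹ (filter (_∈? R) L) (τ c ⟨$⟩ˡ x)              ≡⟨ cong (λ K → Π⁻¹ K x) (filter-accept (_∈? R) c∈R) ⟨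
      Π⁻¹ (filter (_∈? R) (c ∷ L)) x                   ∎
      where
      c₁≢e₁ = proj₁ (⋠⋡-distinctEnds (R⋠e c∈R) (All.lookup c⋡L e∈L))
      c₂≢e₂ = proj₂ (⋠⋡-distinctEnds (R⋠e c∈R) (All.lookup c⋡L e∈L))
    by-cases (no c∉R) = begin
      Π⁻¹ (filter (_∈? e ∷ R) (c ∷ L)) (τ e ⟨$⟩ˡ x)   ≡⟨ cong (λ K → Π⁻¹ K (τ e ⟨$⟩ˡ x)) (filter-reject (_∈? e ∷ R) c∉e∷R) ⟩
      Π⁻¹ (filter (_∈? e ∷ R) L) (τ e ⟨$⟩ˡ x)         ≡⟨ Π⁻¹-remove L sortedL e∈L R⋠e x ⟩
      Π⁻¹ (filter (_∈? R) L) x                       ≡⟨ cong (λ K → Π⁻¹ K x) (filter-reject (_∈? R) c∉R) ⟨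
      Π⁻¹ (filter (_∈? R) (c ∷ L)) x                 ∎
      where
      c∉e∷R : c ∉ e ∷ R
      c∉e∷R (here refl) = All.lookup c⋡L e∈L (⪯-refl e)
      c∉e∷R (there c∈R) = c∉R c∈R

-- Running Γ on Π(G)

addEdge-same : (u v : Fin n) (H : Graph n) → addEdge (u , v) H u v ≡ true
addEdge-same u v H with u ≟ u | v ≟ v
... | yes _ | yes _ = refl
... | no u≢u | _ = contradiction refl u≢u
... | yes _ | no v≢v = contradiction refl v≢v

addEdge-other : {u v x y : Fin n} (H : Graph n) → (x , y) ≢ (u , v) → addEdge (u , v) H x y ≡ H x y
addEdge-other {u = u} {v} {x} {y} H xy≢uv with x ≟ u | y ≟ v
... | yes refl | yes refl = contradiction refl xy≢uv
... | yes _ | no _ = refl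
... | no _ | _ = refl

module Reconstruction {n : ℕ} (G : Graph n) (terrainG : TerrainLike G)
  (LE : List (Pair n)) (validLE : ValidOrdering (λ e → G (proj₁ e) (proj₂ e) ≡ true) LE)
  (LA : List (Pair n)) (validLA : ValidOrdering AllPairs LA) where

  -- R is the suffix of LA that Γ has not visited yet.
  remaining : List (Pair n) → List (Pair n)
  remaining R = filter (_∈? R) LE

  ∈-LA : {u v : Fin n} → u < v → (u , v) ∈ LA
  ∈-LA u<v = validOrdering-complete validLA u<v tt

  edge⇒∈-LE : {u v : Fin n} → u < v → G u v ≡ true → (u , v) ∈ LE
  edge⇒∈-LE = validOrdering-complete validLE

  sorted-remaining : (R : List (Pair n)) → Sorted (remaining R)
  sorted-remaining R = sorted-filter⁺ (_∈? R) (validOrdering-sorted validLE)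

  terrainClosed-remaining : {R : List (Pair n)} → UpperSegment LA R → TerrainClosed (remaining R)
  terrainClosed-remaining {R} seg a b c d a<b b<c c<d ac∈ bd∈ =
    ∈-filter⁺ (_∈? R) (edge⇒∈-LE a<d (terrainG a b c d a<b b<c c<d (validOrdering-sound validLE ac∈LE)
                                                           (validOrdering-sound validLE bd∈LE)))
                      (upward seg ac∈R (∈-LA a<d) (≤-refl , ℕ.<⇒≤ c<d))
    where
    a<d : a < d
    a<d = ℕ.<-trans a<b (ℕ.<-trans b<c c<d)
    ac∈LE : (a , c) ∈ LE
    ac∈LE = proj₁ (∈-filter⁻ (_∈? R) {xs = LE} ac∈)
    ac∈R : (a , c) ∈ R
    ac∈R = proj₂ (∈-filter⁻ (_∈? R) {xs = LE} ac∈)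
    bd∈LE : (b , d) ∈ LE
    bd∈LE = proj₁ (∈-filter⁻ (_∈? R) {xs = LE} bd∈)

  module _ {u v : Fin n} {R : List (Pair n)} (seg : UpperSegment LA ((u , v) ∷ R)) where

    private
      u<v : u < v
      u<v = validOrdering-ordered validLA (⊆U seg (here refl))
      R⋠uv : ∀ {c} → c ∈ R → ¬ (c ⪯ (u , v))
      R⋠uv = All.lookup (AllPairs.head (sorted seg))

    remaining-nonEdge : G u v ≡ false → remaining ((u , v) ∷ R) ≡ remaining R
    remaining-nonEdge nonEdge = filter-∈?-fresh LE (All.tabulate λ { c∈LE refl → ¬edge (validOrdering-sound validLE c∈LE) })
      where
      ¬edge : G u v ≢ true
      ¬edge edge = contradiction (trans (sym nonEdge) edge) λ ()

    Π⁻¹-remaining-edge : G u v ≡ true → (x : Fin (n * 2)) →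
      Π⁻¹ (remaining ((u , v) ∷ R)) (τ (u , v) ⟨$⟩ˡ x) ≡ Π⁻¹ (remaining R) x
    Π⁻¹-remaining-edge edge = Π⁻¹-remove LE (validOrdering-sorted validLE) (edge⇒∈-LE u<v edge) R⋠uv

    edgeConfig-remaining : edgeConfigAt (Π⁻¹ (remaining ((u , v) ∷ R)) (evenPt u))
                                        (Π⁻¹ (remaining ((u , v) ∷ R)) (oddPt v)) ≡ G u v
    edgeConfig-remaining with G u v in g
    ... | false = apart-Π (terrainClosed-remaining seg) (sorted-remaining _) u<v nothingBelow
      where
      nothingBelow : ∀ {c} → c ∈ remaining ((u , v) ∷ R) → ¬ (c ⪯ (u , v))
      nothingBelow c∈ with ∈-filter⁻ (_∈? (u , v) ∷ R) {xs = LE} c∈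
      ... | c∈LE , here refl = λ _ → contradiction (trans (sym g) (validOrdering-sound validLE c∈LE)) λ ()
      ... | _ , there c∈R = R⋠uv c∈R
    ... | true = begin
      edgeConfigAt (Π⁻¹ S (evenPt u)) (Π⁻¹ S (oddPt v))
        ≡⟨ cong₂ edgeConfigAt (cong (Π⁻¹ S) (τ-oddPt {a = u} {v})) (cong (Π⁻¹ S) (τ-evenPt {a = u} {v})) ⟨
      edgeConfigAt (Π⁻¹ S (τ (u , v) ⟨$⟩ˡ oddPt v)) (Π⁻¹ S (τ (u , v) ⟨$⟩ˡ evenPt u))
        ≡⟨ cong₂ edgeConfigAt (Π⁻¹-remaining-edge g (oddPt v)) (Π⁻¹-remaining-edge g (evenPt u)) ⟩
      edgeConfigAt (Π⁻¹ S′ (oddPt v)) (Π⁻¹ S′ (evenPt u))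
        ≡⟨ edgeConfigAt-flip {p = Π⁻¹ S′ (evenPt u)} {Π⁻¹ S′ (oddPt v)} (λ eq → evenPt≢oddPt u v (⟨$⟩ˡ-injective (Π S′) eq)) ⟩
      not (edgeConfigAt (Π⁻¹ S′ (evenPt u)) (Π⁻¹ S′ (oddPt v)))
        ≡⟨ cong not (apart-Π (terrainClosed-remaining (upperSegment-tail seg)) (sorted-remaining R) u<v
                             (R⋠uv ∘ proj₂ ∘ ∈-filter⁻ (_∈? R) {xs = LE})) ⟩
      true ∎
      where
      open ≡-Reasoning
      S = remaining ((u , v) ∷ R)
      S′ = remaining R

  record Recorded (H : Graph n) (R : List (Pair n)) : Set where
    field
      settled : ∀ u v → u < v → (u , v) ∉ R → H u v ≡ G u v
      pending : ∀ {u v} → (u , v) ∈ R → H u v ≡ false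

  open Recorded

  module _ {u v : Fin n} {R : List (Pair n)} {H : Graph n} (rec : Recorded H ((u , v) ∷ R)) where

    recorded-nonEdge : G u v ≡ false → Recorded H R
    recorded-nonEdge nonEdge = record { settled = settled′ ; pending = pending rec ∘ there }
      where
      settled′ : ∀ x y → x < y → (x , y) ∉ R → H x y ≡ G x y
      settled′ x y x<y xy∉R with (x , y) ≟ₚ (u , v)
      ... | yes refl = trans (pending rec (here refl)) (sym nonEdge)
      ... | no xy≢uv = settled rec x y x<y λ { (here xy≡uv) → xy≢uv xy≡uv ; (there xy∈R) → xy∉R xy∈R }

    recorded-edge : G u v ≡ true → (u , v) ∉ R → Recorded (addEdge (u , v) H) R
    recorded-edge edge uv∉R = record { settled = settled′ ; pending = pending′ }
      where
      settled′ : ∀ x y → x < y → (x , y) ∉ R → addEdge (u , v) H x y ≡ G x y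
      settled′ x y x<y xy∉R with (x , y) ≟ₚ (u , v)
      ... | yes refl = trans (addEdge-same u v H) (sym edge)
      ... | no xy≢uv = trans (addEdge-other H xy≢uv)
                             (settled rec x y x<y λ { (here xy≡uv) → xy≢uv xy≡uv ; (there xy∈R) → xy∉R xy∈R })
      pending′ : ∀ {x y} → (x , y) ∈ R → addEdge (u , v) H x y ≡ false
      pending′ xy∈R = trans (addEdge-other H λ { refl → uv∉R xy∈R }) (pending rec (there xy∈R))

  Γ-loop : (R : List (Pair n)) → UpperSegment LA R → (σ : Perm n) (H : Graph n) →
    (∀ x → σ ⟨$⟩ˡ x ≡ Π⁻¹ (remaining R) x) → Recorded H R →
    proj₂ (foldl ΓStep (σ , H) R) ≐ G
  Γ-loop [] _ _ _ _ rec u v u<v = settled rec u v u<v λ ()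
  Γ-loop ((u , v) ∷ R) seg σ H σ≗Π⁻¹ rec
    rewrite trans (cong₂ edgeConfigAt (σ≗Π⁻¹ (evenPt u)) (σ≗Π⁻¹ (oddPt v))) (edgeConfig-remaining seg)
    with G u v in g
  ... | true = Γ-loop R (upperSegment-tail seg) (_·_ {n} (τ (u , v)) σ) (addEdge (u , v) H)
                      (λ x → trans (σ≗Π⁻¹ (τ (u , v) ⟨$⟩ˡ x)) (Π⁻¹-remaining-edge seg g x))
                      (recorded-edge rec g λ uv∈R → All.lookup (AllPairs.head (sorted seg)) uv∈R (⪯-refl (u , v)))
  ... | false = Γ-loop R (upperSegment-tail seg) σ H
                       (λ x → trans (σ≗Π⁻¹ x) (cong (λ K → Π⁻¹ K x) (remaining-nonEdge seg g)))
                       (recorded-nonEdge rec g)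

  Γ-Π : Γ LA (Π LE) ≐ G
  Γ-Π = Γ-loop LA (upperSegment-refl (validOrdering-sorted validLA)) (Π LE) emptyGraph
               (λ x → cong (λ K → Π⁻¹ K x) (sym remaining-all)) recorded-initially
    where
    remaining-all : remaining LA ≡ LE
    remaining-all = filter-all (_∈? LA) (All.tabulate λ c∈LE → ∈-LA (validOrdering-ordered validLE c∈LE))
    recorded-initially : Recorded emptyGraph LA
    recorded-initially = record { settled = λ u v u<v uv∉LA → contradiction (∈-LA u<v) uv∉LA ; pending = λ _ → refl }

mainTheorem10 : (n : ℕ) (G : Graph n) → TerrainLike G →
    (LE : List (Pair n)) → ValidOrdering (λ e → G (proj₁ e) (proj₂ e) ≡ true) LE →
    (LA : List (Pair n)) → ValidOrdering AllPairs LA →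
    Γ LA (Π LE) ≐ G
mainTheorem10 n G terrainG LE validLE LA validLA = Reconstruction.Γ-Π G terrainG LE validLE LA validLA
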